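{- Let $T$ be the complete $q$-ary tree of depth $d$ ($q\ge 2$), and let $S\subseteq V(T)$ be aeolian-compressed. Suppose $u,v$ are two vertices on the same level of $T$ with $u$ to the left of $v$, and that both $\mathrm{Desc}(u)\cap S$ and $\mathrm{Desc}(v)\cap S$ are nonempty. Then either $\mathrm{Desc}(u)\setminus S=\emptyset$ or $\mathrm{Desc}(u)\setminus S=\{u\}$.
   Context: The complete $q$-ary tree of depth $d$ is the rooted tree in which every vertex at distance less than $d$ from the root has exactly $q$ children, and vertices at distance $d$ are leaves. $L_i$ is the set of vertices at distance $i$ from the root; $\mathrm{children}(w)$ denotes the children of $w$ and $\mathrm{Desc}(w)$ its descendants (including $w$). The vertices are linearly ordered breadth-first: the root first; vertices of $L_i$ before those of $L_j$ for $i<j$; within a level, if $x$ precedes $y$ then all children of $x$ precede all children of $y$; children $w^{(1)},\dots,w^{(q)}$ of $w$ appear in this order. A vertex $x$ is to the left of $y$ if they are in the same level and $x$ precedes $y$. For $S\subseteq V(T)$, $\delta(S)=\{x\notin S: N(x)\cap S\neq\emptyset\}$. Two vertices $u,v$ are swappable in $S$ if $u$ is to the left of $v$ and either $u\notin S,\ v\in S$, or $u,v\notin S$, $\mathrm{children}(u)\cap S=\emptyset$, $\mathrm{children}(v)\cap S\ne\emptyset$; $S$ is left-compressed if no pair is swappable in $S$. Vertices $u\in S$, $v\notin S$ are down-swappable in $S$ if $|\delta((S\cup\{v\})\setminus\{u\})|<|\delta(S)|$, or equality holds and $v$ is further from the root than $u$; $S$ is down-compressed if no pair is down-swappable in $S$.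 An aeolian compression of $S$ is a set $S'$ obtained, for some vertices $u,v$ with $u$ to the left of $v$, by removing a positive number $k$ of vertices of $\mathrm{Desc}(v)\cap S$ from $S$ and adding $k$ vertices of $\mathrm{Desc}(u)\setminus S$, such that $|\delta(S')|\le|\delta(S)|$. $S$ is aeolian-compressed if it is left-compressed, down-compressed, and admits no aeolian compression. -}

module Defs where

open import Data.Nat using (ℕ; zero; suc; _≤_; _<_)
open import Data.Nat.Properties using (≤-irrelevant)
open import Data.Fin using (Fin; toℕ)
open import Data.Fin.Properties using (toℕ≤pred[n])
import Data.Fin.Properties as FinP
open import Data.Bool using (Bool; true; false; _∧_; _∨_; not; if_then_else_)
open import Data.List using (List; []; _∷_; _++_; [_]; length; map; concatMap; allFin)
open import Data.Bool.ListAction using (any)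
open import Data.List.Properties using (≡-dec)
open import Data.Vec using (Vec; toList) renaming ([] to []ᵥ; _∷_ to _∷ᵥ_)
open import Data.Vec.Properties using (length-toList)
open import Data.Product using (Σ; ∃; _×_; _,_)
open import Data.Sum using (_⊎_)
open import Data.Empty using (⊥)
open import Relation.Nullary using (¬_; Dec; yes; no)
open import Relation.Nullary.Decidable using (⌊_⌋)
open import Relation.Binary.PropositionalEquality using (_≡_; _≢_; refl; sym; subst; cong)

-- A vertex of the complete q-ary tree of depth d is the path from the root
-- to it: a list of child indices (first entry = step taken at the root),
-- of length at most d.
record Vertex (q d : ℕ) : Set where
  constructor vtx
  field
    path  : List (Fin q)
    valid : length path ≤ d
open Vertex public

module _ {q d : ℕ} where

  level : Vertex q d → ℕ
  level x = length (path x)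

  _≟V_ : (x y : Vertex q d) → Dec (x ≡ y)
  vtx p a ≟V vtx p' b with ≡-dec FinP._≟_ p p'
  ... | no ne = no λ { refl → ne refl }
  ... | yes refl with ≤-irrelevant a b
  ...   | refl = yes refl

  _==_ : Vertex q d → Vertex q d → Bool
  x == y = ⌊ x ≟V y ⌋

allVecs : (q n : ℕ) → List (Vec (Fin q) n)
allVecs q zero = []ᵥ ∷ []
allVecs q (suc n) = concatMap (λ c → map (c ∷ᵥ_) (allVecs q n)) (allFin q)

-- enumeration of all vertices of T (each exactly once)
allVertices : (q d : ℕ) → List (Vertex q d)
allVertices q d = concatMap (λ i → map (mk i) (allVecs q (toℕ i))) (allFin (suc d))
  where
  mk : (i : Fin (suc d)) → Vec (Fin q) (toℕ i) → Vertex q d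
  mk i v = vtx (toList v) (subst (_≤ d) (sym (length-toList v)) (toℕ≤pred[n] i))

count : {A : Set} → (A → Bool) → List A → ℕ
count f [] = 0
count f (x ∷ xs) = if f x then suc (count f xs) else count f xs

VSet : (q d : ℕ) → Set
VSet q d = Vertex q d → Bool

module _ {q d : ℕ} where

  ∣_∣ₛ : VSet q d → ℕ
  ∣ S ∣ₛ = count S (allVertices q d)

  IsChild : Vertex q d → Vertex q d → Set
  IsChild x w = Σ (Fin q) λ c → path x ≡ path w ++ [ c ]

  isChildB : Vertex q d → Vertex q d → Bool
  isChildB x w = any (λ c → ⌊ ≡-dec FinP._≟_ (path x) (path w ++ [ c ]) ⌋) (allFin q)

  adjB : Vertex q d → Vertex q d → Bool
  adjB x y = isChildB x y ∨ isChildB y x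

  -- x ∈ Desc(w)  (descendants, including w itself)
  Desc : Vertex q d → Vertex q d → Set
  Desc w x = Σ (List (Fin q)) λ ys → path x ≡ path w ++ ys

  δ : VSet q d → VSet q d
  δ S x = not (S x) ∧ any (λ y → S y ∧ adjB x y) (allVertices q d)

  -- lexicographic order on equal-length paths = breadth-first order within a level
  LexLt : List (Fin q) → List (Fin q) → Set
  LexLt [] _ = ⊥
  LexLt (_ ∷ _) [] = ⊥
  LexLt (a ∷ as) (b ∷ bs) = (toℕ a < toℕ b) ⊎ (a ≡ b × LexLt as bs)

  LeftOf : Vertex q d → Vertex q d → Set
  LeftOf x y = (level x ≡ level y) × LexLt (path x) (path y)

  Swappable : VSet q d → Vertex q d → Vertex q d → Set
  Swappable S u v = LeftOf u v ×
    ( (S u ≡ false × S v ≡ true)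
    ⊎ (S u ≡ false × S v ≡ false
       × (∀ x → IsChild x u → S x ≡ false)
       × (Σ (Vertex q d) λ x → IsChild x v × S x ≡ true)))

  LeftCompressed : VSet q d → Set
  LeftCompressed S = ∀ u v → ¬ Swappable S u v

  swapSet : VSet q d → Vertex q d → Vertex q d → VSet q d
  swapSet S u v x = (S x ∨ (x == v)) ∧ not (x == u)

  DownSwappable : VSet q d → Vertex q d → Vertex q d → Set
  DownSwappable S u v = S u ≡ true × S v ≡ false ×
    ( (∣ δ (swapSet S u v) ∣ₛ < ∣ δ S ∣ₛ)
    ⊎ (∣ δ (swapSet S u v) ∣ₛ ≡ ∣ δ S ∣ₛ × level u < level v))

  DownCompressed : VSet q d → Set
  DownCompressed S = ∀ u v → ¬ DownSwappable S u v

  replaceSet : VSet q d → VSet q d → VSet q d → VSet q d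
  replaceSet S A B x = (S x ∧ not (A x)) ∨ B x

  IsAeolianCompression : VSet q d → VSet q d → Set
  IsAeolianCompression S S' =
    Σ (Vertex q d) λ u → Σ (Vertex q d) λ v → LeftOf u v ×
    Σ (VSet q d) λ A → Σ (VSet q d) λ B →
      (∀ x → A x ≡ true → Desc v x × S x ≡ true) ×
      (∀ x → B x ≡ true → Desc u x × S x ≡ false) ×
      ∣ A ∣ₛ ≡ ∣ B ∣ₛ × 0 < ∣ A ∣ₛ ×
      (∀ x → S' x ≡ replaceSet S A B x) ×
      ∣ δ S' ∣ₛ ≤ ∣ δ S ∣ₛ

  AeolianCompressed : VSet q d → Set
  AeolianCompressed S = LeftCompressed S × DownCompressed S ×
    (∀ S' → ¬ IsAeolianCompression S S')

-- Suppose some x₀ ≠ u below u is missing from S while S meets Desc(v). Descending from x₀ we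
-- reach w below u with a child x ∉ S and all grandchildren in S; descending inside S below v we
-- reach y ∈ S with no child or grandchild in S. Moving y to x adds at most y and w to the
-- boundary, since everything below x is already in S. If y is not a leaf, two of its children
-- (q ≥ 2) leave the boundary. If y is a leaf and x is not, x leaves it and one of y, w does not
-- enter it, except when w ∉ S ∪ δ(S) and the parent r of y is in S; then y and r move onto x and
-- a sibling of x, both of which leave the boundary. If x and y are both leaves they are
-- swappable, contradicting left-compression.
module Submission where

open import Defs
open import Data.Nat using (ℕ; zero; suc; _+_; _≤_; _<_; z≤n; s≤s; _<?_)
open import Data.Nat.Properties hiding (_≟_)
open import Algebra.Properties.CommutativeSemigroup +-commutativeSemigroup using (interchange)
open import Data.Bool using (Bool; true; false; _∧_; _∨_; _≟_)
open import Data.Bool.Properties using (¬-not; ∨-zeroʳ; ∨-identityʳ; ∧-zeroʳ; T-≡)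
open import Data.Bool.ListAction using (any)
open import Data.Fin using (Fin; toℕ; fromℕ<) renaming (zero to fzero; suc to fsuc)
import Data.Fin.Properties as Fin
open import Data.List using (List; []; _∷_; _++_; [_]; length; map; concat; concatMap; allFin; tabulate; initLast; _∷ʳ′_)
open import Data.List.Properties using (≡-dec; map-tabulate; ∷-injective; length-++; ++-assoc; ++-identityʳ; ∷ʳ-injectiveˡ; ∷ʳ-injectiveʳ)
open import Data.List.Membership.Propositional using (_∈_; lose)
open import Data.List.Membership.Propositional.Properties using (∈-allFin)
open import Data.List.Relation.Unary.Any using (here; there; satisfied)
open import Data.List.Relation.Unary.Any.Properties using (any⁺; any⁻)
open import Data.Vec using (Vec; toList) renaming (_∷_ to _∷ᵥ_)
open import Data.Vec.Properties using (length-toList)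
open import Data.Product using (Σ; _×_; _,_; proj₁; proj₂)
import Data.Product as Product
open import Data.Sum using (_⊎_; inj₁; inj₂)
import Data.Sum as Sum
open import Data.Empty using (⊥; ⊥-elim)
open import Function using (_∘_; Equivalence)
open import Relation.Nullary using (¬_; Dec; yes; no)
open import Relation.Nullary.Decidable using (⌊_⌋; map′)
open import Relation.Binary.PropositionalEquality hiding ([_])

⌊⌋-sound : {P : Set} (p? : Dec P) → ⌊ p? ⌋ ≡ true → P
⌊⌋-sound (yes p) _ = p

⌊⌋-complete : {P : Set} (p? : Dec P) → P → ⌊ p? ⌋ ≡ true
⌊⌋-complete (yes _) _ = refl
⌊⌋-complete (no ¬p) p = ⊥-elim (¬p p)

⌊⌋-cong : {P Q : Set} (p? : Dec P) (q? : Dec Q) → (P → Q) → (Q → P) → ⌊ p? ⌋ ≡ ⌊ q? ⌋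
⌊⌋-cong (yes _) (yes _) _ _ = refl
⌊⌋-cong (yes p) (no ¬q) f _ = ⊥-elim (¬q (f p))
⌊⌋-cong (no ¬p) (yes q) _ g = ⊥-elim (¬p (g q))
⌊⌋-cong (no _) (no _) _ _ = refl

∨-true : (a b : Bool) → a ∨ b ≡ true → a ≡ true ⊎ b ≡ true
∨-true true _ _ = inj₁ refl
∨-true false _ e = inj₂ e

∧-true : (a b : Bool) → a ∧ b ≡ true → a ≡ true × b ≡ true
∧-true true true _ = refl , refl

any-true⁻ : {A : Set} (p : A → Bool) (xs : List A) → any p xs ≡ true → Σ A λ x → p x ≡ true
any-true⁻ p xs = Product.map₂ (Equivalence.to T-≡) ∘ satisfied ∘ any⁻ p xs ∘ Equivalence.from T-≡

any-true⁺ : {A : Set} (p : A → Bool) {x : A} {xs : List A} → x ∈ xs → p x ≡ true → any p xs ≡ true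
any-true⁺ p x∈xs px = Equivalence.to T-≡ (any⁺ p (lose x∈xs (Equivalence.from T-≡ px)))

true≢false : true ≢ false
true≢false ()

≢true⇒≡false : {b : Bool} → b ≢ true → b ≡ false
≢true⇒≡false = ¬-not

≢false⇒≡true : {b : Bool} → b ≢ false → b ≡ true
≢false⇒≡true = ¬-not

ind : Bool → ℕ
ind true = 1
ind false = 0

ind-exchange : (f g i o : Bool) → (o ≡ true → f ≡ false × g ≡ true) → (f ≡ true → g ≡ true ⊎ i ≡ true) →
  ind f + ind o ≤ ind g + ind i
ind-exchange f g i true ho _ with ho refl
... | refl , refl = s≤s z≤n
ind-exchange false g i false _ _ = z≤n
ind-exchange true g i false _ hf with hf refl
... | inj₁ refl = s≤s z≤n
... | inj₂ refl = m≤n+m 1 (ind g)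

module _ {A : Set} where

  count-∷ : (f : A → Bool) (x : A) (xs : List A) → count f (x ∷ xs) ≡ ind (f x) + count f xs
  count-∷ f x xs with f x
  ... | true = refl
  ... | false = refl

  count-++ : (f : A → Bool) (xs ys : List A) → count f (xs ++ ys) ≡ count f xs + count f ys
  count-++ f [] ys = refl
  count-++ f (x ∷ xs) ys with f x
  ... | true = cong suc (count-++ f xs ys)
  ... | false = count-++ f xs ys

  count-map : {B : Set} (f : B → Bool) (g : A → B) (xs : List A) → count f (map g xs) ≡ count (f ∘ g) xs
  count-map f g [] = refl
  count-map f g (x ∷ xs) with f (g x)
  ... | true = cong suc (count-map f g xs)
  ... | false = count-map f g xs

  count-cong : {f g : A → Bool} → (∀ x → f x ≡ g x) → (xs : List A) → count f xs ≡ count g xs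
  count-cong f≗g [] = refl
  count-cong {f} {g} f≗g (x ∷ xs) rewrite f≗g x with g x
  ... | true = cong suc (count-cong f≗g xs)
  ... | false = count-cong f≗g xs

  count-none : {f : A → Bool} → (∀ x → f x ≡ false) → (xs : List A) → count f xs ≡ 0
  count-none f≡false [] = refl
  count-none {f} f≡false (x ∷ xs) rewrite f≡false x = count-none f≡false xs

  count-pos⇒∈ : (f : A → Bool) (xs : List A) → 0 < count f xs → Σ A λ x → x ∈ xs × f x ≡ true
  count-pos⇒∈ f (x ∷ xs) pos with f x in fx
  ... | true = x , here refl , fx
  ... | false with count-pos⇒∈ f xs pos
  ...   | y , y∈xs , fy = y , there y∈xs , fy

  count-∨ : (f g : A → Bool) → (∀ x → f x ≡ true → g x ≡ false) → (xs : List A) →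
            count (λ x → f x ∨ g x) xs ≡ count f xs + count g xs
  count-∨ f g disj [] = refl
  count-∨ f g disj (x ∷ xs) with f x in fx | g x in gx
  ... | true | true with () ← trans (sym gx) (disj x fx)
  ... | true | false = cong suc (count-∨ f g disj xs)
  ... | false | true = trans (cong suc (count-∨ f g disj xs)) (sym (+-suc (count f xs) (count g xs)))
  ... | false | false = count-∨ f g disj xs

  count-concat-none : (f : A → Bool) {n : ℕ} (G : Fin n → List A) →
    (∀ i → count f (G i) ≡ 0) → count f (concat (tabulate G)) ≡ 0
  count-concat-none f {zero} G none = refl
  count-concat-none f {suc n} G none =
    trans (count-++ f (G fzero) _) (cong₂ _+_ (none fzero) (count-concat-none f (G ∘ fsuc) (none ∘ fsuc)))

  count-concat-unique : (f : A → Bool) {n : ℕ} (G : Fin n → List A) (j : Fin n) →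
    count f (G j) ≡ 1 → (∀ i → i ≢ j → count f (G i) ≡ 0) → count f (concat (tabulate G)) ≡ 1
  count-concat-unique f G fzero once others =
    trans (count-++ f (G fzero) _)
      (cong₂ _+_ once (count-concat-none f (G ∘ fsuc) λ i → others (fsuc i) λ ()))
  count-concat-unique f G (fsuc j) once others =
    trans (count-++ f (G fzero) _)
      (cong₂ _+_ (others fzero λ ()) (count-concat-unique f (G ∘ fsuc) j once
        λ i i≢j → others (fsuc i) (i≢j ∘ Fin.suc-injective)))

  count-exchange : (f g i o : A → Bool) →
    (∀ x → o x ≡ true → f x ≡ false × g x ≡ true) → (∀ x → f x ≡ true → g x ≡ true ⊎ i x ≡ true) →
    (xs : List A) → count f xs + count o xs ≤ count g xs + count i xs
  count-exchange f g i o ho hf [] = z≤n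
  count-exchange f g i o ho hf (x ∷ xs) = begin
    count f (x ∷ xs) + count o (x ∷ xs)
      ≡⟨ cong₂ _+_ (count-∷ f x xs) (count-∷ o x xs) ⟩
    (ind (f x) + count f xs) + (ind (o x) + count o xs)
      ≡⟨ interchange (ind (f x)) (count f xs) (ind (o x)) (count o xs) ⟩
    (ind (f x) + ind (o x)) + (count f xs + count o xs)
      ≤⟨ +-mono-≤ (ind-exchange (f x) (g x) (i x) (o x) (ho x) (hf x)) (count-exchange f g i o ho hf xs) ⟩
    (ind (g x) + ind (i x)) + (count g xs + count i xs)
      ≡⟨ interchange (ind (g x)) (ind (i x)) (count g xs) (count i xs) ⟩
    (ind (g x) + count g xs) + (ind (i x) + count i xs)
      ≡⟨ sym (cong₂ _+_ (count-∷ g x xs) (count-∷ i x xs)) ⟩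
    count g (x ∷ xs) + count i (x ∷ xs) ∎
    where open ≤-Reasoning


  count-≤-by-exchange : (f g i o : A → Bool) →
    (∀ x → o x ≡ true → f x ≡ false × g x ≡ true) → (∀ x → f x ≡ true → g x ≡ true ⊎ i x ≡ true) →
    (xs : List A) → count i xs ≤ count o xs → count f xs ≤ count g xs
  count-≤-by-exchange f g i o ho hf xs i≤o = +-cancelʳ-≤ (count o xs) _ _
    (≤-trans (count-exchange f g i o ho hf xs) (+-monoʳ-≤ (count g xs) i≤o))

concatMap-allFin : {A : Set} {n : ℕ} (G : Fin n → List A) → concatMap G (allFin n) ≡ concat (tabulate G)
concatMap-allFin G = cong concat (map-tabulate (λ i → i) G)

hasList : {q n : ℕ} → List (Fin q) → Vec (Fin q) n → Bool
hasList p v = ⌊ ≡-dec Fin._≟_ (toList v) p ⌋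

count-allVecs : (q : ℕ) (p : List (Fin q)) → count (hasList p) (allVecs q (length p)) ≡ 1
count-allVecs q [] = refl
count-allVecs q (c ∷ p) = begin
  count (hasList (c ∷ p)) (concatMap block (allFin q)) ≡⟨ cong (count (hasList (c ∷ p))) (concatMap-allFin block) ⟩
  count (hasList (c ∷ p)) (concat (tabulate block))   ≡⟨ count-concat-unique (hasList (c ∷ p)) block c own others ⟩
  1                                                    ∎
  where
  open ≡-Reasoning
  vs : List (Vec (Fin q) (length p))
  vs = allVecs q (length p)
  block : Fin q → List (Vec (Fin q) (suc (length p)))
  block c' = map (c' ∷ᵥ_) vs
  own : count (hasList (c ∷ p)) (block c) ≡ 1
  own = begin
    count (hasList (c ∷ p)) (block c)    ≡⟨ count-map (hasList (c ∷ p)) (c ∷ᵥ_) vs ⟩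
    count (hasList (c ∷ p) ∘ (c ∷ᵥ_)) vs ≡⟨ count-cong (λ v → ⌊⌋-cong _ _ (proj₂ ∘ ∷-injective) (cong (c ∷_))) vs ⟩
    count (hasList p) vs                 ≡⟨ count-allVecs q p ⟩
    1                                    ∎
  others : ∀ i → i ≢ c → count (hasList (c ∷ p)) (block i) ≡ 0
  others i i≢c = trans (count-map (hasList (c ∷ p)) (i ∷ᵥ_) vs)
    (count-none (λ v → ≢true⇒≡false (i≢c ∘ proj₁ ∘ ∷-injective ∘ ⌊⌋-sound _)) vs)

exists-other : {q : ℕ} {f₀ f₁ : Fin q} → f₀ ≢ f₁ → (c : Fin q) → Σ (Fin q) λ c' → c ≢ c'
exists-other {f₀ = f₀} {f₁} f₀≢f₁ c with c Fin.≟ f₀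
... | yes refl = f₁ , f₀≢f₁
... | no c≢f₀ = f₀ , c≢f₀

module _ {q d : ℕ} where

  vertex-≡ : {x y : Vertex q d} → path x ≡ path y → x ≡ y
  vertex-≡ {vtx p a} {vtx .p b} refl = cong (vtx p) (≤-irrelevant a b)

  ==-refl : (x : Vertex q d) → (x == x) ≡ true
  ==-refl x = ⌊⌋-complete (x ≟V x) refl

  ==⇒≡ : (x y : Vertex q d) → (x == y) ≡ true → x ≡ y
  ==⇒≡ x y = ⌊⌋-sound (x ≟V y)

  ≢⇒==false : (x y : Vertex q d) → x ≢ y → (x == y) ≡ false
  ≢⇒==false x y x≢y = ≢true⇒≡false (x≢y ∘ ==⇒≡ x y)

  ⁅_⁆ : Vertex q d → VSet q d
  ⁅ a ⁆ z = z == a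

  _∪_ : VSet q d → VSet q d → VSet q d
  (X ∪ Y) z = X z ∨ Y z

  -- Generalised over the indexing function because allVertices builds its
  -- vertices with a local helper.
  count-levels : (mk : (i : Fin (suc d)) → Vec (Fin q) (toℕ i) → Vertex q d) →
    (∀ i v → path (mk i v) ≡ toList v) → (a : Vertex q d) →
    count ⁅ a ⁆ (concatMap (λ i → map (mk i) (allVecs q (toℕ i))) (allFin (suc d))) ≡ 1
  count-levels mk path-mk a = begin
    count ⁅ a ⁆ (concatMap block (allFin (suc d))) ≡⟨ cong (count ⁅ a ⁆) (concatMap-allFin block) ⟩
    count ⁅ a ⁆ (concat (tabulate block))          ≡⟨ count-concat-unique ⁅ a ⁆ block j own others ⟩
    1                                              ∎
    where
    open ≡-Reasoning
    block : (i : Fin (suc d)) → List (Vertex q d)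
    block i = map (mk i) (allVecs q (toℕ i))
    j : Fin (suc d)
    j = fromℕ< (s≤s (valid a))
    toℕj : toℕ j ≡ level a
    toℕj = Fin.toℕ-fromℕ< (s≤s (valid a))
    path-of : ∀ i v → mk i v ≡ a → toList v ≡ path a
    path-of i v e = trans (sym (path-mk i v)) (cong path e)
    level-of : ∀ i v → mk i v ≡ a → i ≡ j
    level-of i v e = Fin.toℕ-injective (begin
      toℕ i             ≡⟨ sym (length-toList v) ⟩
      length (toList v) ≡⟨ cong length (path-of i v e) ⟩
      level a           ≡⟨ sym toℕj ⟩
      toℕ j             ∎)
    own : count ⁅ a ⁆ (block j) ≡ 1
    own = begin
      count ⁅ a ⁆ (block j)                          ≡⟨ count-map ⁅ a ⁆ (mk j) (allVecs q (toℕ j)) ⟩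
      count (⁅ a ⁆ ∘ mk j) (allVecs q (toℕ j))        ≡⟨ count-cong (λ v → ⌊⌋-cong _ _ (path-of j v)
                                                           (λ e → vertex-≡ (trans (path-mk j v) e))) (allVecs q (toℕ j)) ⟩
      count (hasList (path a)) (allVecs q (toℕ j))   ≡⟨ cong (λ n → count (hasList (path a)) (allVecs q n)) toℕj ⟩
      count (hasList (path a)) (allVecs q (level a)) ≡⟨ count-allVecs q (path a) ⟩
      1                                              ∎
    others : ∀ i → i ≢ j → count ⁅ a ⁆ (block i) ≡ 0
    others i i≢j = trans (count-map ⁅ a ⁆ (mk i) (allVecs q (toℕ i)))
      (count-none (λ v → ≢true⇒≡false (i≢j ∘ level-of i v ∘ ==⇒≡ (mk i v) a)) (allVecs q (toℕ i)))

  ∣⁅⁆∣ : (a : Vertex q d) → ∣ ⁅ a ⁆ ∣ₛ ≡ 1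
  ∣⁅⁆∣ = count-levels _ (λ _ _ → refl)

  ∣⁅⁆∪⁅⁆∣ : {a b : Vertex q d} → a ≢ b → ∣ ⁅ a ⁆ ∪ ⁅ b ⁆ ∣ₛ ≡ 2
  ∣⁅⁆∪⁅⁆∣ {a} {b} a≢b = trans (count-∨ ⁅ a ⁆ ⁅ b ⁆ disjoint (allVertices q d))
    (cong₂ _+_ (∣⁅⁆∣ a) (∣⁅⁆∣ b))
    where
    disjoint : ∀ z → (z == a) ≡ true → (z == b) ≡ false
    disjoint z z=a = ≢⇒==false z b λ z≡b → a≢b (trans (sym (==⇒≡ z a z=a)) z≡b)

  ∈-allVertices : (a : Vertex q d) → a ∈ allVertices q d
  ∈-allVertices a with count-pos⇒∈ ⁅ a ⁆ (allVertices q d) (subst (0 <_) (sym (∣⁅⁆∣ a)) (s≤s z≤n))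
  ... | x , x∈ , x=a = subst (_∈ allVertices q d) (==⇒≡ x a x=a) x∈

  ∈⁅⁆∪⁅⁆ : (a b z : Vertex q d) → (⁅ a ⁆ ∪ ⁅ b ⁆) z ≡ true → z ≡ a ⊎ z ≡ b
  ∈⁅⁆∪⁅⁆ a b z e with ∨-true (z == a) (z == b) e
  ... | inj₁ z=a = inj₁ (==⇒≡ z a z=a)
  ... | inj₂ z=b = inj₂ (==⇒≡ z b z=b)

  ⁅⁆-elim : (P : Vertex q d → Set) {a : Vertex q d} → P a → ∀ z → ⁅ a ⁆ z ≡ true → P z
  ⁅⁆-elim P {a} Pa z z=a = subst P (sym (==⇒≡ z a z=a)) Pa

  ⁅⁆∪⁅⁆-elim : (P : Vertex q d → Set) {a b : Vertex q d} → P a → P b → ∀ z → (⁅ a ⁆ ∪ ⁅ b ⁆) z ≡ true → P z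
  ⁅⁆∪⁅⁆-elim P {a} {b} Pa Pb z e with ∈⁅⁆∪⁅⁆ a b z e
  ... | inj₁ refl = Pa
  ... | inj₂ refl = Pb

  a∈⁅a⁆∪⁅b⁆ : (a b : Vertex q d) → (⁅ a ⁆ ∪ ⁅ b ⁆) a ≡ true
  a∈⁅a⁆∪⁅b⁆ a b rewrite ==-refl a = refl

  b∈⁅a⁆∪⁅b⁆ : (a b : Vertex q d) → (⁅ a ⁆ ∪ ⁅ b ⁆) b ≡ true
  b∈⁅a⁆∪⁅b⁆ a b rewrite ==-refl b = ∨-zeroʳ (b == a)

  length-∷ʳ : (p : List (Fin q)) (c : Fin q) → length (p ++ [ c ]) ≡ suc (length p)
  length-∷ʳ p c = trans (length-++ p) (+-comm (length p) 1)

  child : (w : Vertex q d) → Fin q → level w < d → Vertex q d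
  child w c lt = vtx (path w ++ [ c ]) (subst (_≤ d) (sym (length-∷ʳ (path w) c)) lt)

  child-isChild : (w : Vertex q d) (c : Fin q) (lt : level w < d) → IsChild (child w c lt) w
  child-isChild w c lt = c , refl

  level-child : (x w : Vertex q d) → IsChild x w → level x ≡ suc (level w)
  level-child x w (c , e) = trans (cong length e) (length-∷ʳ (path w) c)

  parent-level< : (x w : Vertex q d) → IsChild x w → level w < d
  parent-level< x w x⋖w = subst (_≤ d) (level-child x w x⋖w) (valid x)

  parent-unique : (x a b : Vertex q d) → IsChild x a → IsChild x b → a ≡ b
  parent-unique x a b (_ , ea) (_ , eb) =
    vertex-≡ (∷ʳ-injectiveˡ (path a) (path b) (trans (sym ea) eb))

  children-distinct : (x x' w : Vertex q d) (h : IsChild x w) (h' : IsChild x' w) →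
    proj₁ h ≢ proj₁ h' → x ≢ x'
  children-distinct x .x w (c , e) (c' , e') c≢c' refl =
    c≢c' (∷ʳ-injectiveʳ (path w) (path w) (trans (sym e) e'))

  child-≢-parent : (x w : Vertex q d) → IsChild x w → x ≢ w
  child-≢-parent x w x⋖w x≡w = 1+n≢n (trans (sym (level-child x w x⋖w)) (cong level x≡w))

  sibling : {f₀ f₁ : Fin q} → f₀ ≢ f₁ → (x w : Vertex q d) → IsChild x w →
    Σ (Vertex q d) λ x' → IsChild x' w × x ≢ x'
  sibling f₀≢f₁ x w x⋖w with exists-other f₀≢f₁ (proj₁ x⋖w)
  ... | c' , c≢c' = child w c' lt , child-isChild w c' lt , children-distinct x _ w x⋖w (child-isChild w c' lt) c≢c'
    where
    lt : level w < d
    lt = parent-level< x w x⋖w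

  anyChild? : {P : Vertex q d → Set} → (∀ c → Dec (P c)) → (w : Vertex q d) →
    Dec (Σ (Vertex q d) λ c → IsChild c w × P c)
  anyChild? {P} P? w with level w <? d
  ... | no ¬lt = no λ (c , c⋖w , _) → ¬lt (parent-level< c w c⋖w)
  ... | yes lt = map′ (λ (i , p) → child w i lt , child-isChild w i lt , p)
                      (λ { (c , (i , e) , p) → i , subst P (vertex-≡ {x = c} e) p })
                      (Fin.any? (λ i → P? (child w i lt)))

  IsChild⇒Desc : (x w : Vertex q d) → IsChild x w → Desc w x
  IsChild⇒Desc x w (c , e) = [ c ] , e

  Desc-refl : (u : Vertex q d) → Desc u u
  Desc-refl u = [] , sym (++-identityʳ (path u))

  Desc-trans : (u w x : Vertex q d) → Desc u w → Desc w x → Desc u x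
  Desc-trans u w x (ys , ew) (zs , ex) =
    ys ++ zs , trans ex (trans (cong (_++ zs) ew) (++-assoc (path u) ys zs))

  Desc-child : (u w x : Vertex q d) → Desc u w → IsChild x w → Desc u x
  Desc-child u w x u⊒w x⋖w = Desc-trans u w x u⊒w (IsChild⇒Desc x w x⋖w)

  Desc-level : (u x : Vertex q d) → Desc u x → level u ≤ level x
  Desc-level u x (ys , e) =
    subst (level u ≤_) (sym (trans (cong length e) (length-++ (path u)))) (m≤m+n _ _)

  Desc-parent : (u x : Vertex q d) → Desc u x → x ≢ u → Σ (Vertex q d) λ w → Desc u w × IsChild x w
  Desc-parent u x (ys , e) x≢u with initLast ys
  ... | [] = ⊥-elim (x≢u (vertex-≡ (trans e (++-identityʳ (path u)))))
  ... | ys' ∷ʳ′ c = w , (ys' , refl) , (c , path-x)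
    where
    path-x : path x ≡ (path u ++ ys') ++ [ c ]
    path-x = trans e (sym (++-assoc (path u) ys' [ c ]))
    w : Vertex q d
    w = vtx (path u ++ ys') (<⇒≤ (subst (_≤ d) (trans (cong length path-x) (length-∷ʳ (path u ++ ys') c)) (valid x)))

  private
    _≺_ : List (Fin q) → List (Fin q) → Set
    _≺_ = LexLt {q} {d}

  ≺-++ : (p p' ys zs : List (Fin q)) → p ≺ p' → (p ++ ys) ≺ (p' ++ zs)
  ≺-++ (_ ∷ _) (_ ∷ _) ys zs (inj₁ lt) = inj₁ lt
  ≺-++ (_ ∷ p) (_ ∷ p') ys zs (inj₂ (e , p≺p')) = inj₂ (e , ≺-++ p p' ys zs p≺p')

  ≺-irrefl : (p : List (Fin q)) → ¬ (p ≺ p)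
  ≺-irrefl (_ ∷ _) (inj₁ lt) = <-irrefl refl lt
  ≺-irrefl (_ ∷ p) (inj₂ (_ , p≺p)) = ≺-irrefl p p≺p

  LeftOf-Desc-≺ : (u v a b : Vertex q d) → LeftOf u v → Desc u a → Desc v b → path a ≺ path b
  LeftOf-Desc-≺ u v a b (_ , u≺v) (ys , ea) (zs , eb) rewrite ea | eb = ≺-++ (path u) (path v) ys zs u≺v

  Desc-disjoint : (u v a b : Vertex q d) → LeftOf u v → Desc u a → Desc v b → a ≢ b
  Desc-disjoint u v a .a u◁v u⊒a v⊒a refl = ≺-irrefl (path a) (LeftOf-Desc-≺ u v a a u◁v u⊒a v⊒a)

  LeftOf-Desc : (u v a b : Vertex q d) → LeftOf u v → Desc u a → Desc v b → level a ≡ level b → LeftOf a b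
  LeftOf-Desc u v a b u◁v u⊒a v⊒b same = same , LeftOf-Desc-≺ u v a b u◁v u⊒a v⊒b

module _ {q d : ℕ} where

  Adj : Vertex q d → Vertex q d → Set
  Adj z n = IsChild z n ⊎ IsChild n z

  isChildB-sound : (x w : Vertex q d) → isChildB x w ≡ true → IsChild x w
  isChildB-sound x w e = Product.map₂ (⌊⌋-sound _) (any-true⁻ _ (allFin q) e)

  isChildB-complete : (x w : Vertex q d) → IsChild x w → isChildB x w ≡ true
  isChildB-complete x w (c , e) = any-true⁺ _ (∈-allFin c) (⌊⌋-complete _ e)

  adjB-sound : (z n : Vertex q d) → adjB z n ≡ true → Adj z n
  adjB-sound z n e = Sum.map (isChildB-sound z n) (isChildB-sound n z) (∨-true _ _ e)

  adjB-complete : (z n : Vertex q d) → Adj z n → adjB z n ≡ true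
  adjB-complete z n (inj₁ z⋖n) rewrite isChildB-complete z n z⋖n = refl
  adjB-complete z n (inj₂ n⋖z) rewrite isChildB-complete n z n⋖z = ∨-zeroʳ (isChildB z n)

  δ-sound : (S : VSet q d) (z : Vertex q d) → δ S z ≡ true →
    S z ≡ false × Σ (Vertex q d) λ n → S n ≡ true × Adj z n
  δ-sound S z e with S z
  ... | false with any-true⁻ (λ n → S n ∧ adjB z n) (allVertices q d) e
  ...   | n , h with ∧-true (S n) (adjB z n) h
  ...     | Sn , adj = refl , n , Sn , adjB-sound z n adj

  δ-complete : (S : VSet q d) (z n : Vertex q d) → S z ≡ false → S n ≡ true → Adj z n → δ S z ≡ true
  δ-complete S z n Sz Sn adj rewrite Sz =
    any-true⁺ (λ n → S n ∧ adjB z n) (∈-allVertices n) (cong₂ _∧_ Sn (adjB-complete z n adj))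

  ∈⇒∉δ : (S : VSet q d) (z : Vertex q d) → S z ≡ true → δ S z ≡ false
  ∈⇒∉δ S z Sz rewrite Sz = refl

  δ-isolated : (S : VSet q d) (z : Vertex q d) → (∀ n → Adj z n → S n ≡ false) → δ S z ≡ false
  δ-isolated S z isolated = ≢true⇒≡false ∉δ
    where
    ∉δ : δ S z ≢ true
    ∉δ e with δ-sound S z e
    ... | _ , n , Sn , adj with () ← trans (sym (isolated n adj)) Sn

  module _ (S A B : VSet q d) where

    replace-sound : (n : Vertex q d) → replaceSet S A B n ≡ true → (S n ≡ true × A n ≡ false) ⊎ B n ≡ true
    replace-sound n e with S n | A n | B n
    ... | _     | _     | true  = inj₂ refl
    ... | true  | false | false = inj₁ (refl , refl)

    replace-kept : (n : Vertex q d) → S n ≡ true → A n ≡ false → replaceSet S A B n ≡ true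
    replace-kept n Sn An rewrite Sn | An = refl

    replace-added : (n : Vertex q d) → B n ≡ true → replaceSet S A B n ≡ true
    replace-added n Bn rewrite Bn = ∨-zeroʳ _

    replace-absent : (n : Vertex q d) → S n ≡ false → B n ≡ false → replaceSet S A B n ≡ false
    replace-absent n Sn Bn rewrite Sn | Bn = refl

    replace-removed : (n : Vertex q d) → A n ≡ true → B n ≡ false → replaceSet S A B n ≡ false
    replace-removed n An Bn rewrite An | Bn = trans (∨-identityʳ _) (∧-zeroʳ (S n))

    replace-outside : (n : Vertex q d) → replaceSet S A B n ≡ false → A n ≡ false → S n ≡ false
    replace-outside n e An with S n
    ... | false = refl
    ... | true rewrite An with () ← e

    δ-replace : (z : Vertex q d) → δ (replaceSet S A B) z ≡ true →
      δ S z ≡ true ⊎ A z ≡ true ⊎ Σ (Vertex q d) λ n → B n ≡ true × Adj z n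
    δ-replace z e with δ-sound (replaceSet S A B) z e
    ... | Tz , n , Tn , adj with replace-sound n Tn
    ...   | inj₂ Bn = inj₂ (inj₂ (n , Bn , adj))
    ...   | inj₁ (Sn , _) = by-A (A z) refl
      where
      by-A : (b : Bool) → A z ≡ b → δ S z ≡ true ⊎ A z ≡ true ⊎ Σ (Vertex q d) λ n → B n ≡ true × Adj z n
      by-A true Az = inj₂ (inj₁ Az)
      by-A false Az = inj₁ (δ-complete S z n (replace-outside z Tz Az) Sn adj)

module _ {q d : ℕ} (S : VSet q d) where

  NoChildIn : Vertex q d → Set
  NoChildIn y = ∀ c → IsChild c y → S c ≡ false

  NoGrandchildIn : Vertex q d → Set
  NoGrandchildIn y = ∀ c g → IsChild c y → IsChild g c → S g ≡ false

  GrandchildrenIn : Vertex q d → Set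
  GrandchildrenIn w = ∀ c g → IsChild c w → IsChild g c → S g ≡ true

  SparseMemberBelow : Vertex q d → Set
  SparseMemberBelow y₀ = Σ (Vertex q d) λ y → Desc y₀ y × S y ≡ true × NoChildIn y × NoGrandchildIn y

  SaturatedGapBelow : Vertex q d → Set
  SaturatedGapBelow w₀ =
    Σ (Vertex q d) λ w → Desc w₀ w × (Σ (Vertex q d) λ x → IsChild x w × S x ≡ false) × GrandchildrenIn w

  private
    grandchild? : (b : Bool) (w : Vertex q d) →
      Dec (Σ (Vertex q d) λ c → IsChild c w × Σ (Vertex q d) λ g → IsChild g c × S g ≡ b)
    grandchild? b = anyChild? (anyChild? (λ g → S g ≟ b))

    fuel-step : (y y' : Vertex q d) (n : ℕ) → level y < level y' → d < level y + suc n → d < level y' + n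
    fuel-step y y' n deeper h = <-≤-trans h (≤-trans (≤-reflexive (+-suc (level y) n)) (+-monoˡ-≤ n deeper))

    out-of-fuel : (y : Vertex q d) → ¬ (d < level y + 0)
    out-of-fuel y h = <-irrefl refl (<-≤-trans h (≤-trans (≤-reflexive (+-identityʳ (level y))) (valid y)))

    child-deeper : (c y : Vertex q d) → IsChild c y → level y < level c
    child-deeper c y c⋖y = ≤-reflexive (sym (level-child c y c⋖y))

    sparse-lift : (y c : Vertex q d) → Desc y c → SparseMemberBelow c → SparseMemberBelow y
    sparse-lift y c y⊒c (y' , c⊒y' , rest) = y' , Desc-trans y c y' y⊒c c⊒y' , rest

    saturated-lift : (w c : Vertex q d) → Desc w c → SaturatedGapBelow c → SaturatedGapBelow w
    saturated-lift w c w⊒c (w' , c⊒w' , rest) = w' , Desc-trans w c w' w⊒c c⊒w' , rest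

    sparse-member-from : (n : ℕ) (y : Vertex q d) → d < level y + n → S y ≡ true → SparseMemberBelow y
    sparse-member-from zero y h _ = ⊥-elim (out-of-fuel y h)
    sparse-member-from (suc n) y h Sy with anyChild? (λ c → S c ≟ true) y
    ... | yes (c , c⋖y , Sc) = sparse-lift y c (IsChild⇒Desc c y c⋖y)
          (sparse-member-from n c (fuel-step y c n (child-deeper c y c⋖y) h) Sc)
    ... | no noChild with grandchild? true y
    ...   | yes (c , c⋖y , g , g⋖c , Sg) = sparse-lift y g (Desc-child y c g (IsChild⇒Desc c y c⋖y) g⋖c)
            (sparse-member-from n g (fuel-step y g n (<-trans (child-deeper c y c⋖y) (child-deeper g c g⋖c)) h) Sg)
    ...   | no noGrandchild = y , Desc-refl y , Sy , (λ c c⋖y → ≢true⇒≡false λ Sc → noChild (c , c⋖y , Sc))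
            , λ c g c⋖y g⋖c → ≢true⇒≡false λ Sg → noGrandchild (c , c⋖y , g , g⋖c , Sg)

    saturated-gap-from : (n : ℕ) (w x : Vertex q d) → d < level w + n → IsChild x w → S x ≡ false →
      SaturatedGapBelow w
    saturated-gap-from zero w x h x⋖w _ = ⊥-elim (out-of-fuel w h)
    saturated-gap-from (suc n) w x h x⋖w Sx with grandchild? false w
    ... | yes (c , c⋖w , g , g⋖c , Sg) = saturated-lift w c (IsChild⇒Desc c w c⋖w)
          (saturated-gap-from n c g (fuel-step w c n (child-deeper c w c⋖w) h) g⋖c Sg)
    ... | no noGap = w , Desc-refl w , (x , x⋖w , Sx) , λ c g c⋖w g⋖c → ≢false⇒≡true λ Sg → noGap (c , c⋖w , g , g⋖c , Sg)

  sparse-member : (y : Vertex q d) → S y ≡ true → SparseMemberBelow y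
  sparse-member y = sparse-member-from (suc d) y (m≤n+m (suc d) (level y))

  saturated-gap : (w x : Vertex q d) → IsChild x w → S x ≡ false → SaturatedGapBelow w
  saturated-gap w x = saturated-gap-from (suc d) w x (m≤n+m (suc d) (level w))

module _ {q d : ℕ} (S : VSet q d) (compressed : AeolianCompressed S) (u v : Vertex q d) (u◁v : LeftOf u v) where

  -- Every vertex that may enter the boundary (those of I) is paid for by one that leaves it (O).
  no-cheap-exchange : (A B I O : VSet q d) →
    (∀ z → A z ≡ true → Desc v z × S z ≡ true) → (∀ z → B z ≡ true → Desc u z × S z ≡ false) →
    ∣ A ∣ₛ ≡ ∣ B ∣ₛ → 0 < ∣ A ∣ₛ → ∣ I ∣ₛ ≤ ∣ O ∣ₛ →
    (∀ z → O z ≡ true → δ (replaceSet S A B) z ≡ false × δ S z ≡ true) →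
    (∀ z → δ (replaceSet S A B) z ≡ true → δ S z ≡ true ⊎ I z ≡ true) → ⊥
  no-cheap-exchange A B I O A⊆ B⊆ ∣A∣≡∣B∣ ∣A∣>0 ∣I∣≤∣O∣ leaving entering =
    proj₂ (proj₂ compressed) (replaceSet S A B)
      ( u , v , u◁v , A , B , A⊆ , B⊆ , ∣A∣≡∣B∣ , ∣A∣>0 , (λ _ → refl)
      , count-≤-by-exchange (δ (replaceSet S A B)) (δ S) I O leaving entering (allVertices q d) ∣I∣≤∣O∣)

  module _ (f₀ f₁ : Fin q) (f₀≢f₁ : f₀ ≢ f₁) (w x y : Vertex q d)
    (u⊒w : Desc u w) (x⋖w : IsChild x w) (Sx : S x ≡ false) (saturated : GrandchildrenIn S w)
    (v⊒y : Desc v y) (Sy : S y ≡ true) (noChild : NoChildIn S y) (noGrandchild : NoGrandchildIn S y) where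

    private
      u⊒x : Desc u x
      u⊒x = Desc-child u w x u⊒w x⋖w

      disjoint : (a b : Vertex q d) → Desc u a → Desc v b → a ≢ b
      disjoint a b = Desc-disjoint u v a b u◁v

      y≢w : y ≢ w
      y≢w y≡w = disjoint w y u⊒w v⊒y (sym y≡w)

      ∉⁅⁆ : (a n : Vertex q d) → Desc u a → Desc v n → ⁅ a ⁆ n ≡ false
      ∉⁅⁆ a n u⊒a v⊒n = ≢⇒==false n a λ n≡a → disjoint a n u⊒a v⊒n (sym n≡a)

      leaf : (z : Vertex q d) → ¬ (level z < d) → level z ≡ d
      leaf z ¬lt = ≤-antisym (valid z) (≮⇒≥ ¬lt)

      -- Filling B just below w adds no new boundary beneath it, as everything
      -- two levels below w is already in S.
      δ-fill : (A B : VSet q d) → (∀ z → A z ≡ true → Desc v z) → (∀ z → B z ≡ true → IsChild z w) →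
        ∀ z → δ (replaceSet S A B) z ≡ true → δ S z ≡ true ⊎ A z ≡ true ⊎ z ≡ w
      δ-fill A B A⊆ B⊆ z e with δ-replace S A B z e
      ... | inj₁ δSz = inj₁ δSz
      ... | inj₂ (inj₁ Az) = inj₂ (inj₁ Az)
      ... | inj₂ (inj₂ (n , Bn , inj₂ n⋖z)) = inj₂ (inj₂ (parent-unique n z w n⋖z (B⊆ n Bn)))
      ... | inj₂ (inj₂ (n , Bn , inj₁ z⋖n)) = ⊥-elim (true≢false (trans (sym e) (∈⇒∉δ (replaceSet S A B) z z-kept)))
        where
        z-kept : replaceSet S A B z ≡ true
        z-kept = replace-kept S A B z (saturated n z (B⊆ n Bn) z⋖n)
          (≢true⇒≡false λ Az → disjoint z z (Desc-child u n z (Desc-child u w n u⊒w (B⊆ n Bn)) z⋖n) (A⊆ z Az) refl)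

      gap-in-boundary : (z : Vertex q d) → IsChild z w → S z ≡ false → level z < d → δ S z ≡ true
      gap-in-boundary z z⋖w Sz lt =
        δ-complete S z g Sz (saturated z g z⋖w (child-isChild z f₀ lt)) (inj₂ (child-isChild z f₀ lt))
        where
        g : Vertex q d
        g = child z f₀ lt

      S₁ : VSet q d
      S₁ = replaceSet S ⁅ y ⁆ ⁅ x ⁆

      x∈S₁ : S₁ x ≡ true
      x∈S₁ = replace-added S ⁅ y ⁆ ⁅ x ⁆ x (==-refl x)

      δ-S₁ : ∀ z → δ S₁ z ≡ true → δ S z ≡ true ⊎ z ≡ y ⊎ z ≡ w
      δ-S₁ z e with δ-fill ⁅ y ⁆ ⁅ x ⁆ (⁅⁆-elim (Desc v) v⊒y) (⁅⁆-elim (λ z → IsChild z w) x⋖w) z e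
      ... | inj₁ δSz = inj₁ δSz
      ... | inj₂ (inj₁ z=y) = inj₂ (inj₁ (==⇒≡ z y z=y))
      ... | inj₂ (inj₂ z≡w) = inj₂ (inj₂ z≡w)

      no-cheap-swap : (I O : VSet q d) → ∣ I ∣ₛ ≤ ∣ O ∣ₛ →
        (∀ z → O z ≡ true → δ S₁ z ≡ false × δ S z ≡ true) → (∀ z → δ S₁ z ≡ true → δ S z ≡ true ⊎ I z ≡ true) → ⊥
      no-cheap-swap I O = no-cheap-exchange ⁅ y ⁆ ⁅ x ⁆ I O
        (⁅⁆-elim (λ z → Desc v z × S z ≡ true) (v⊒y , Sy)) (⁅⁆-elim (λ z → Desc u z × S z ≡ false) (u⊒x , Sx))
        (trans (∣⁅⁆∣ y) (sym (∣⁅⁆∣ x))) (subst (0 <_) (sym (∣⁅⁆∣ y)) (s≤s z≤n))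

      y-internal : level y < d → ⊥
      y-internal lt = no-cheap-swap (⁅ y ⁆ ∪ ⁅ w ⁆) (⁅ c₀ ⁆ ∪ ⁅ c₁ ⁆)
        (≤-reflexive (trans (∣⁅⁆∪⁅⁆∣ y≢w) (sym (∣⁅⁆∪⁅⁆∣ c₀≢c₁))))
        (⁅⁆∪⁅⁆-elim (λ z → δ S₁ z ≡ false × δ S z ≡ true) (leaving c₀ c₀⋖y) (leaving c₁ c₁⋖y))
        entering
        where
        c₀ c₁ : Vertex q d
        c₀ = child y f₀ lt
        c₁ = child y f₁ lt
        c₀⋖y : IsChild c₀ y
        c₀⋖y = child-isChild y f₀ lt
        c₁⋖y : IsChild c₁ y
        c₁⋖y = child-isChild y f₁ lt
        c₀≢c₁ : c₀ ≢ c₁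
        c₀≢c₁ = children-distinct c₀ c₁ y c₀⋖y c₁⋖y f₀≢f₁
        leaving : (c : Vertex q d) → IsChild c y → δ S₁ c ≡ false × δ S c ≡ true
        leaving c c⋖y = δ-isolated S₁ c outside , δ-complete S c y (noChild c c⋖y) Sy (inj₁ c⋖y)
          where
          outside : ∀ n → Adj c n → S₁ n ≡ false
          outside n (inj₁ c⋖n) rewrite parent-unique c n y c⋖n c⋖y =
            replace-removed S ⁅ y ⁆ ⁅ x ⁆ y (==-refl y) (∉⁅⁆ x y u⊒x v⊒y)
          outside n (inj₂ n⋖c) = replace-absent S ⁅ y ⁆ ⁅ x ⁆ n (noGrandchild c n c⋖y n⋖c)
            (∉⁅⁆ x n u⊒x (Desc-child v c n (Desc-child v y c v⊒y c⋖y) n⋖c))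
        entering : ∀ z → δ S₁ z ≡ true → δ S z ≡ true ⊎ (⁅ y ⁆ ∪ ⁅ w ⁆) z ≡ true
        entering z e with δ-S₁ z e
        ... | inj₁ δSz = inj₁ δSz
        ... | inj₂ (inj₁ refl) = inj₂ (a∈⁅a⁆∪⁅b⁆ y w)
        ... | inj₂ (inj₂ refl) = inj₂ (b∈⁅a⁆∪⁅b⁆ y w)

      leaves-swappable : level x ≡ d → level y ≡ d → ⊥
      leaves-swappable lx ly =
        proj₁ compressed x y (LeftOf-Desc u v x y u◁v u⊒x v⊒y (trans lx (sym ly)) , inj₁ (Sx , Sy))

      w-touched : level x < d → S w ≡ true ⊎ δ S w ≡ true → ⊥
      w-touched lt touched = no-cheap-swap ⁅ y ⁆ ⁅ x ⁆ (≤-reflexive (trans (∣⁅⁆∣ y) (sym (∣⁅⁆∣ x))))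
        (⁅⁆-elim (λ z → δ S₁ z ≡ false × δ S z ≡ true) (∈⇒∉δ S₁ x x∈S₁ , gap-in-boundary x x⋖w Sx lt))
        entering
        where
        entering : ∀ z → δ S₁ z ≡ true → δ S z ≡ true ⊎ ⁅ y ⁆ z ≡ true
        entering z e with δ-S₁ z e
        ... | inj₁ δSz = inj₁ δSz
        ... | inj₂ (inj₁ refl) = inj₂ (==-refl y)
        ... | inj₂ (inj₂ refl) = inj₁ (w-boundary touched)
          where
          w-boundary : S w ≡ true ⊎ δ S w ≡ true → δ S w ≡ true
          w-boundary (inj₂ δSw) = δSw
          w-boundary (inj₁ Sw) = ⊥-elim (true≢false (trans (sym e)
            (∈⇒∉δ S₁ w (replace-kept S ⁅ y ⁆ ⁅ x ⁆ w Sw (≢⇒==false w y (y≢w ∘ sym))))))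

      module _ (ly : level y ≡ d) (lt : level x < d) (Sw : S w ≡ false) (δSw : δ S w ≡ false) where

        y≢v : y ≢ v
        y≢v y≡v = <-irrefl refl (begin-strict
          d             ≡⟨ trans (sym ly) (trans (cong level y≡v) (sym (proj₁ u◁v))) ⟩
          level u       ≤⟨ Desc-level u w u⊒w ⟩
          level w       <⟨ ≤-reflexive (sym (level-child x w x⋖w)) ⟩
          level x       <⟨ lt ⟩
          d             ∎)
          where open ≤-Reasoning

        parent : Σ (Vertex q d) λ r → Desc v r × IsChild y r
        parent = Desc-parent v y v⊒y y≢v

        r : Vertex q d
        r = proj₁ parent

        v⊒r : Desc v r
        v⊒r = proj₁ (proj₂ parent)

        y⋖r : IsChild y r
        y⋖r = proj₂ (proj₂ parent)

        only-neighbour : (T : VSet q d) → T r ≡ false → δ T y ≡ false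
        only-neighbour T Tr = δ-isolated T y λ where
          n (inj₁ y⋖n) → subst (λ n → T n ≡ false) (parent-unique y r n y⋖r y⋖n) Tr
          n (inj₂ n⋖y) → ⊥-elim (<-irrefl ly (parent-level< n y n⋖y))

        parent-out : S r ≡ false → ⊥
        parent-out Sr = no-cheap-swap ⁅ w ⁆ ⁅ x ⁆ (≤-reflexive (trans (∣⁅⁆∣ w) (sym (∣⁅⁆∣ x))))
          (⁅⁆-elim (λ z → δ S₁ z ≡ false × δ S z ≡ true) (∈⇒∉δ S₁ x x∈S₁ , gap-in-boundary x x⋖w Sx lt))
          entering
          where
          y∉δS₁ : δ S₁ y ≡ false
          y∉δS₁ = only-neighbour S₁ (replace-absent S ⁅ y ⁆ ⁅ x ⁆ r Sr (∉⁅⁆ x r u⊒x v⊒r))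
          entering : ∀ z → δ S₁ z ≡ true → δ S z ≡ true ⊎ ⁅ w ⁆ z ≡ true
          entering z e with δ-S₁ z e
          ... | inj₁ δSz = inj₁ δSz
          ... | inj₂ (inj₁ refl) = ⊥-elim (true≢false (trans (sym e) y∉δS₁))
          ... | inj₂ (inj₂ refl) = inj₂ (==-refl w)

        parent-in : S r ≡ true → ⊥
        parent-in Sr = no-cheap-exchange A B I B
          (⁅⁆∪⁅⁆-elim (λ z → Desc v z × S z ≡ true) (v⊒y , Sy) (v⊒r , Sr))
          (⁅⁆∪⁅⁆-elim (λ z → Desc u z × S z ≡ false) (u⊒x , Sx) (u⊒x' , Sx'))
          (trans (∣⁅⁆∪⁅⁆∣ (child-≢-parent y r y⋖r)) (sym (∣⁅⁆∪⁅⁆∣ x≢x'))) (subst (0 <_) (sym (∣⁅⁆∪⁅⁆∣ (child-≢-parent y r y⋖r))) (s≤s z≤n))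
          (≤-reflexive (trans (∣⁅⁆∪⁅⁆∣ w≢r) (sym (∣⁅⁆∪⁅⁆∣ x≢x'))))
          (⁅⁆∪⁅⁆-elim (λ z → δ S₂ z ≡ false × δ S z ≡ true)
            (∈⇒∉δ S₂ x (replace-added S A B x (a∈⁅a⁆∪⁅b⁆ x x')) , gap-in-boundary x x⋖w Sx lt)
            (∈⇒∉δ S₂ x' (replace-added S A B x' (b∈⁅a⁆∪⁅b⁆ x x')) , gap-in-boundary x' x'⋖w Sx' lt'))
          entering
          where
          x' : Vertex q d
          x' = proj₁ (sibling f₀≢f₁ x w x⋖w)
          x'⋖w : IsChild x' w
          x'⋖w = proj₁ (proj₂ (sibling f₀≢f₁ x w x⋖w))
          x≢x' : x ≢ x'
          x≢x' = proj₂ (proj₂ (sibling f₀≢f₁ x w x⋖w))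
          u⊒x' : Desc u x'
          u⊒x' = Desc-child u w x' u⊒w x'⋖w
          Sx' : S x' ≡ false
          Sx' = ≢true⇒≡false λ Sx' → true≢false (trans (sym (δ-complete S w x' Sw Sx' (inj₂ x'⋖w))) δSw)
          lt' : level x' < d
          lt' = subst (_< d) (trans (level-child x w x⋖w) (sym (level-child x' w x'⋖w))) lt
          w≢r : w ≢ r
          w≢r = disjoint w r u⊒w v⊒r
          A B I : VSet q d
          A = ⁅ y ⁆ ∪ ⁅ r ⁆
          B = ⁅ x ⁆ ∪ ⁅ x' ⁆
          I = ⁅ w ⁆ ∪ ⁅ r ⁆
          S₂ : VSet q d
          S₂ = replaceSet S A B
          y∉δS₂ : δ S₂ y ≡ false
          y∉δS₂ = only-neighbour S₂ (replace-removed S A B r (b∈⁅a⁆∪⁅b⁆ y r)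
            (cong₂ _∨_ (∉⁅⁆ x r u⊒x v⊒r) (∉⁅⁆ x' r u⊒x' v⊒r)))
          entering : ∀ z → δ S₂ z ≡ true → δ S z ≡ true ⊎ I z ≡ true
          entering z e with δ-fill A B (⁅⁆∪⁅⁆-elim (Desc v) v⊒y v⊒r) (⁅⁆∪⁅⁆-elim (λ z → IsChild z w) x⋖w x'⋖w) z e
          ... | inj₁ δSz = inj₁ δSz
          ... | inj₂ (inj₂ refl) = inj₂ (a∈⁅a⁆∪⁅b⁆ w r)
          ... | inj₂ (inj₁ Az) with ∈⁅⁆∪⁅⁆ y r z Az
          ...   | inj₁ refl = ⊥-elim (true≢false (trans (sym e) y∉δS₂))
          ...   | inj₂ refl = inj₂ (b∈⁅a⁆∪⁅b⁆ w r)

        w-untouched : ⊥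
        w-untouched with S r in Sr
        ... | true = parent-in Sr
        ... | false = parent-out Sr

    configuration-impossible : ⊥
    configuration-impossible with level y <? d | level x <? d
    ... | yes y-lt | _ = y-internal y-lt
    ... | no y-nlt | no x-nlt = leaves-swappable (leaf x x-nlt) (leaf y y-nlt)
    ... | no y-nlt | yes x-lt = by-w (S w) (δ S w) refl refl
      where
      by-w : (b c : Bool) → S w ≡ b → δ S w ≡ c → ⊥
      by-w true _ Sw _ = w-touched x-lt (inj₁ Sw)
      by-w false true _ δSw = w-touched x-lt (inj₂ δSw)
      by-w false false Sw δSw = w-untouched (leaf y y-nlt) x-lt Sw δSw

  gap-free : (f₀ f₁ : Fin q) → f₀ ≢ f₁ → (x₀ : Vertex q d) → Desc u x₀ → x₀ ≢ u → S x₀ ≡ false →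
    (y₀ : Vertex q d) → Desc v y₀ → S y₀ ≡ true → ⊥
  gap-free f₀ f₁ f₀≢f₁ x₀ u⊒x₀ x₀≢u Sx₀ y₀ v⊒y₀ Sy₀ with Desc-parent u x₀ u⊒x₀ x₀≢u
  ... | w₀ , u⊒w₀ , x₀⋖w₀ with saturated-gap S w₀ x₀ x₀⋖w₀ Sx₀ | sparse-member S y₀ Sy₀
  ...   | w , w₀⊒w , (x , x⋖w , Sx) , saturated | y , y₀⊒y , Sy , noChild , noGrandchild =
    configuration-impossible f₀ f₁ f₀≢f₁ w x y (Desc-trans u w₀ w u⊒w₀ w₀⊒w) x⋖w Sx saturated
      (Desc-trans v y₀ y v⊒y₀ y₀⊒y) Sy noChild noGrandchild

all-or-all-but-root : {q d : ℕ} (S : VSet q d) (u : Vertex q d) → (∀ x → Desc u x → x ≢ u → S x ≡ true) →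
  (∀ x → Desc u x → S x ≡ true) ⊎ (S u ≡ false × (∀ x → Desc u x → x ≢ u → S x ≡ true))
all-or-all-but-root S u below with S u in Su
... | false = inj₂ (refl , below)
... | true = inj₁ everywhere
  where
  everywhere : ∀ x → Desc u x → S x ≡ true
  everywhere x u⊒x with x ≟V u
  ... | yes refl = Su
  ... | no x≢u = below x u⊒x x≢u

lemma2p7 : (q d : ℕ) → 2 ≤ q → (S : VSet q d) → AeolianCompressed S →
    (u v : Vertex q d) → LeftOf u v →
    Σ (Vertex q d) (λ x → Desc u x × S x ≡ true) →
    Σ (Vertex q d) (λ x → Desc v x × S x ≡ true) →
    (∀ x → Desc u x → S x ≡ true)
    ⊎ (S u ≡ false × (∀ x → Desc u x → x ≢ u → S x ≡ true))
lemma2p7 q d (s≤s (s≤s _)) S compressed u v u◁v _ (y₀ , v⊒y₀ , Sy₀) =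
  all-or-all-but-root S u λ x u⊒x x≢u → ≢false⇒≡true λ Sx →
    gap-free S compressed u v u◁v fzero (fsuc fzero) (λ ()) x u⊒x x≢u Sx y₀ v⊒y₀ Sy₀
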